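{- Let $q$ be a prime of the form $q = 12k \pm 7$ for some integer $k$. Then the unit-quadrance graph $D_q$ contains no triangle.
   Context: $F_q$ is the finite field with $q$ elements. The quadrance between $A_1 = (x_1,y_1)$ and $A_2 = (x_2,y_2)$ in $F_q^2$ is $Q(A_1,A_2) = (x_2-x_1)^2 + (y_2-y_1)^2$. The unit-quadrance graph $D_q$ has vertex set $F_q^2$, with $A_1, A_2$ adjacent if and only if $Q(A_1,A_2) = 1$. A triangle is a set of three pairwise adjacent vertices. -}

module Defs where

open import Data.Nat using (ℕ)
open import Data.Integer using (ℤ; +_; _-_; _+_; _*_)
open import Data.Integer.Divisibility using (_∣_)
open import Data.Product using (_×_)
open import Relation.Nullary using (¬_)

-- The prime field F_q (q prime) is modelled as ℤ modulo q:
-- an element is represented by an integer, and two integers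
-- represent the same element iff q divides their difference.
_≡_[mod_] : ℤ → ℤ → ℕ → Set
a ≡ b [mod q ] = (+ q) ∣ (a - b)

Point : Set
Point = ℤ × ℤ

SamePoint : ℕ → Point → Point → Set
SamePoint q (x₁ Data.Product., y₁) (x₂ Data.Product., y₂) =
  (x₁ ≡ x₂ [mod q ]) × (y₁ ≡ y₂ [mod q ])

quadrance : Point → Point → ℤ
quadrance (x₁ Data.Product., y₁) (x₂ Data.Product., y₂) =
  (x₂ - x₁) * (x₂ - x₁) + (y₂ - y₁) * (y₂ - y₁)

Adjacent : ℕ → Point → Point → Set
Adjacent q A B = ¬ SamePoint q A B × (quadrance A B ≡ + 1 [mod q ])

IsTriangle : ℕ → Point → Point → Point → Set
IsTriangle q A B C = Adjacent q A B × Adjacent q B C × Adjacent q A C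

-- A triangle ABC with unit quadrances satisfies Archimedes' identity
-- (2·cross(A,B,C))² = 4·Q(A,B)·Q(A,C) − (Q(A,B) + Q(A,C) − Q(B,C))², so 3 is a square r² modulo q.
-- Let t = 1/2 in F_q and ζ = t(r + i) in F_q[i]; then ζ³ = i and ζ¹² = 1. The Frobenius map gives
-- ζ^q = t(r + i^q). For q = 12n + 5 this is ζ again while ζ^q = ζ⁵, so ζ² = ζ⁶ = −1; for q = 12n + 7
-- it is the conjugate of ζ while ζ^q = ζ⁷ = −ζ. Comparing coordinates, r ≡ 0 in both cases,
-- so q divides 3, which is impossible since q ≥ 5.
module Submission where

open import Defs
open import Level using (0ℓ)
open import Algebra.Bundles using (Semiring; CommutativeSemiring)
import Algebra.Definitions.RawMonoid as RawMonoid
open import Algebra.Structures using (IsCommutativeSemiring)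
open import Algebra.Structures.Biased using (isCommutativeSemiringˡ; isCommutativeMonoidˡ)
open import Data.Fin as Fin using (Fin; toℕ; inject₁; fromℕ)
open import Data.Fin.Properties using (toℕ-inject₁; toℕ-fromℕ; toℕ<n)
open import Data.List using (_∷_; [])
open import Data.Nat as ℕ using (ℕ; zero; suc; s≤s; z≤n; _!)
import Data.Nat.Properties as ℕ
open import Data.Nat.Combinatorics.Specification using (nCk≡n!/k![n-k]!)
open import Data.Nat.Divisibility using (_∣_; _∤_; divides-refl; ∣⇒≤; ∣1⇒≡1; m∣m*n)
open import Data.Nat.DivMod using (m/n*n≡m)
open import Data.Nat.Primality using (Prime; prime⇒nonZero; euclidsLemma; ¬prime[1])
import Data.Nat.Tactic.RingSolver as ℕ-Solver
open import Data.Product using (∃; _,_)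
open import Data.Sum using (_⊎_; inj₁; inj₂; [_,_]′)
open import Function using (id)
open import Relation.Binary.Bundles using (Setoid)
open import Relation.Binary.Structures using (IsEquivalence)
open import Relation.Binary.PropositionalEquality as ≡ using (_≡_)
import Relation.Binary.Reasoning.Setoid as SetoidReasoning
open import Relation.Nullary using (¬_; contradiction)

module _ where
  open import Data.Nat using (_∸_; _<_)
  open import Data.Nat.Combinatorics using (_C_; k![n∸k]!∣n!)

  prime∤! : ∀ {p m} → Prime p → m < p → p ∤ m !
  prime∤! {m = zero}  pp _   p∣1 = ¬prime[1] (≡.subst Prime (∣1⇒≡1 p∣1) pp)
  prime∤! {m = suc m} pp m<p p∣m! with euclidsLemma (suc m) (m !) pp p∣m!
  ... | inj₁ p∣1+m = ℕ.<⇒≱ m<p (∣⇒≤ p∣1+m)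
  ... | inj₂ p∣m!  = prime∤! pp (ℕ.<-trans (ℕ.n<1+n m) m<p) p∣m!

  prime∣C : ∀ {p k} → Prime p → 0 < k → k < p → p ∣ p C k
  prime∣C {p} {k} pp 0<k k<p =
    [ id , (λ p∣ → contradiction p∣ p∤k![p∸k]!) ]′
      (euclidsLemma (p C k) (k ! ℕ.* (p ∸ k) !) pp p∣C*k![p∸k]!)
    where
    instance
      k![p∸k]!≢0 : ℕ.NonZero (k ! ℕ.* (p ∸ k) !)
      k![p∸k]!≢0 = k ℕ.!* (p ∸ k) !≢0
    k≤p : k ℕ.≤ p
    k≤p = ℕ.<⇒≤ k<p
    n∣n! : ∀ {n} → 0 < n → n ∣ n !
    n∣n! {suc n} _ = m∣m*n (n !)
    C*k![p∸k]!≡p! : (p C k) ℕ.* (k ! ℕ.* (p ∸ k) !) ≡ p !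
    C*k![p∸k]!≡p! rewrite nCk≡n!/k![n-k]! k≤p = m/n*n≡m (k![n∸k]!∣n! k≤p)
    p∣C*k![p∸k]! : p ∣ (p C k) ℕ.* (k ! ℕ.* (p ∸ k) !)
    p∣C*k![p∸k]! = ≡.subst (p ∣_) (≡.sym C*k![p∸k]!≡p!) (n∣n! (ℕ.<-trans 0<k k<p))
    p∤k![p∸k]! : p ∤ k ! ℕ.* (p ∸ k) !
    p∤k![p∸k]! p∣ = [ prime∤! pp k<p , prime∤! pp (ℕ.∸-monoʳ-< 0<k k≤p) ]′
                      (euclidsLemma (k !) ((p ∸ k) !) pp p∣)

module Powers {a ℓ} (S : Semiring a ℓ) where
  open Semiring S
  open import Algebra.Properties.Semiring.Exp S
  open SetoidReasoning setoid

  1^n≈1 : ∀ n → 1# ^ n ≈ 1#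
  1^n≈1 zero    = refl
  1^n≈1 (suc n) = trans (*-identityˡ (1# ^ n)) (1^n≈1 n)

  ^-periodic : ∀ {x m} → x ^ m ≈ 1# → ∀ k s → x ^ (m ℕ.* k ℕ.+ s) ≈ x ^ s
  ^-periodic {x} {m} xᵐ≈1 k s = begin
    x ^ (m ℕ.* k ℕ.+ s)    ≈⟨ ^-homo-* x (m ℕ.* k) s ⟩
    x ^ (m ℕ.* k) * x ^ s  ≈⟨ *-congʳ (^-assocʳ x m k) ⟨
    (x ^ m) ^ k * x ^ s    ≈⟨ *-congʳ (trans (^-congˡ k xᵐ≈1) (1^n≈1 k)) ⟩
    1# * x ^ s             ≈⟨ *-identityˡ (x ^ s) ⟩
    x ^ s                  ∎

module Frobenius {a ℓ} (S : CommutativeSemiring a ℓ) where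
  open CommutativeSemiring S
  open RawMonoid +-rawMonoid using (_×_)
  open import Algebra.Properties.Semiring.Exp semiring using (_^_)
  open import Algebra.Properties.Semiring.Mult semiring using (×-assoc-*)
  open import Algebra.Properties.Monoid.Mult +-monoid using (×-congʳ; ×-assocˡ)
  open import Algebra.Properties.Monoid.Sum +-monoid using (sum; sum-cong-≋; sum-replicate-zero; sum-init-last)
  open import Algebra.Properties.CommutativeSemiring.Binomial S
  open import Data.Nat.Combinatorics using (_C_; nCn≡1)
  open Powers semiring using (1^n≈1)
  open SetoidReasoning setoid

  module _ {p} (p-prime : Prime p) (char : p × 1# ≈ 0#) where

    p×x≈0 : ∀ x → p × x ≈ 0#
    p×x≈0 x = begin
      p × x         ≈⟨ ×-congʳ p (*-identityˡ x) ⟨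
      p × (1# * x)  ≈⟨ ×-assoc-* p 1# x ⟨
      (p × 1#) * x  ≈⟨ *-congʳ char ⟩
      0# * x        ≈⟨ zeroˡ x ⟩
      0#            ∎

    ∣⇒×≈0 : ∀ {n} → p ∣ n → ∀ x → n × x ≈ 0#
    ∣⇒×≈0 (divides-refl c) x = begin
      (c ℕ.* p) × x  ≡⟨ ≡.cong (_× x) (ℕ.*-comm c p) ⟩
      (p ℕ.* c) × x  ≈⟨ ×-assocˡ x p c ⟨
      p × (c × x)    ≈⟨ p×x≈0 (c × x) ⟩
      0#             ∎

    private
      p≡1+m : p ≡ suc (ℕ.pred p)
      p≡1+m = ≡.sym (ℕ.suc-pred p {{prime⇒nonZero p-prime}})

    module _ (x y : Carrier) where
      private
        t : (n : ℕ) → Fin (suc n) → Carrier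
        t = binomialTerm x y

      inner-terms≈0 : ∀ {m} → suc m ≡ p → (i : Fin m) → t (suc m) (Fin.suc (inject₁ i)) ≈ 0#
      inner-terms≈0 {m} ≡.refl i = ∣⇒×≈0 (prime∣C p-prime (s≤s z≤n) (s≤s i<m)) _
        where
        i<m : toℕ (inject₁ i) ℕ.< m
        i<m = ≡.subst (ℕ._< _) (≡.sym (toℕ-inject₁ i)) (toℕ<n i)

      first-term : ∀ n → t n Fin.zero ≈ y ^ n
      first-term n = trans (+-identityʳ (1# * y ^ n)) (*-identityˡ (y ^ n))

      last-term : ∀ n k → k ≡ n → (n C k) × (x ^ k * y ^ (n ℕ.∸ k)) ≈ x ^ n
      last-term n .n ≡.refl rewrite nCn≡1 n | ℕ.n∸n≡0 n =
        trans (+-identityʳ (x ^ n * 1#)) (*-identityʳ (x ^ n))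

      binomialExpansion-char : ∀ {m} → suc m ≡ p → binomialExpansion x y (suc m) ≈ x ^ suc m + y ^ suc m
      binomialExpansion-char {m} 1+m≡p = begin
        t (suc m) Fin.zero + sum (λ i → t (suc m) (Fin.suc i))
          ≈⟨ +-cong (first-term (suc m)) (sum-init-last (λ i → t (suc m) (Fin.suc i))) ⟩
        y ^ suc m + (sum (λ i → t (suc m) (Fin.suc (inject₁ i))) + t (suc m) (Fin.suc (fromℕ m)))
          ≈⟨ +-congˡ (+-cong (sum-cong-≋ (inner-terms≈0 1+m≡p))
                             (last-term (suc m) _ (≡.cong suc (toℕ-fromℕ m)))) ⟩
        y ^ suc m + (sum {m} (λ _ → 0#) + x ^ suc m)
          ≈⟨ +-congˡ (trans (+-congʳ (sum-replicate-zero m)) (+-identityˡ (x ^ suc m))) ⟩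
        y ^ suc m + x ^ suc m
          ≈⟨ +-comm (y ^ suc m) (x ^ suc m) ⟩
        x ^ suc m + y ^ suc m ∎

      frobenius : (x + y) ^ p ≈ x ^ p + y ^ p
      frobenius = frobenius′ p≡1+m
        where
        frobenius′ : ∀ {m} → p ≡ suc m → (x + y) ^ p ≈ x ^ p + y ^ p
        frobenius′ ≡.refl = trans (theorem p x y) (binomialExpansion-char ≡.refl)

    fermat : ∀ n → (n × 1#) ^ p ≈ n × 1#
    fermat zero    = 0^p≈0 p≡1+m
      where
      0^p≈0 : ∀ {m} → p ≡ suc m → 0# ^ p ≈ 0#
      0^p≈0 ≡.refl = zeroˡ _
    fermat (suc n) = begin
      (1# + n × 1#) ^ p      ≈⟨ frobenius 1# (n × 1#) ⟩
      1# ^ p + (n × 1#) ^ p  ≈⟨ +-cong (1^n≈1 p) (fermat n) ⟩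
      1# + n × 1#            ∎

open import Data.Integer using (ℤ; +_; -[1+_]; _+_; _-_; _*_; -_)
import Data.Integer.Properties as ℤ
open import Data.Integer.DivMod using (_%ℕ_; _/ℕ_; a≡a%ℕn+[a/ℕn]*n)
open import Data.Integer.Divisibility.Signed using (divides; ∣ᵤ⇒∣; ∣⇒∣ᵤ)
open import Data.Integer.Tactic.RingSolver using (solve-∀; solve)

-- Unlike _≡_[mod_], the quotient is explicit, so a congruence can be matched against ≡.refl.
module Congruence (M : ℤ) where

  infix 4 _≡ₘ_
  record _≡ₘ_ (a b : ℤ) : Set where
    constructor _,_
    field
      quotient : ℤ
      equation : a ≡ b + quotient * M

  infixr 4 _,_

  ≡ₘ-refl : ∀ {a} → a ≡ₘ a
  ≡ₘ-refl {a} = + 0 , solve (a ∷ M ∷ [])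

  ≡⇒≡ₘ : ∀ {a b} → a ≡ b → a ≡ₘ b
  ≡⇒≡ₘ ≡.refl = ≡ₘ-refl

  ≡ₘ-sym : ∀ {a b} → a ≡ₘ b → b ≡ₘ a
  ≡ₘ-sym {b = b} (k , ≡.refl) = - k , solve (b ∷ k ∷ M ∷ [])

  ≡ₘ-trans : ∀ {a b c} → a ≡ₘ b → b ≡ₘ c → a ≡ₘ c
  ≡ₘ-trans {c = c} (k , ≡.refl) (l , ≡.refl) = l + k , solve (c ∷ k ∷ l ∷ M ∷ [])

  ≡ₘ-isEquivalence : IsEquivalence _≡ₘ_
  ≡ₘ-isEquivalence = record { refl = ≡ₘ-refl ; sym = ≡ₘ-sym ; trans = ≡ₘ-trans }

  ≡ₘ-setoid : Setoid 0ℓ 0ℓ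
  ≡ₘ-setoid = record { isEquivalence = ≡ₘ-isEquivalence }

  +-congₘ : ∀ {a b c d} → a ≡ₘ b → c ≡ₘ d → a + c ≡ₘ b + d
  +-congₘ {b = b} {d = d} (k , ≡.refl) (l , ≡.refl) = k + l , solve (b ∷ d ∷ k ∷ l ∷ M ∷ [])

  sub-congₘ : ∀ {a b c d} → a ≡ₘ b → c ≡ₘ d → a - c ≡ₘ b - d
  sub-congₘ {b = b} {d = d} (k , ≡.refl) (l , ≡.refl) = k - l , solve (b ∷ d ∷ k ∷ l ∷ M ∷ [])

  *-congₘ : ∀ {a b c d} → a ≡ₘ b → c ≡ₘ d → a * c ≡ₘ b * d
  *-congₘ {b = b} {d = d} (k , ≡.refl) (l , ≡.refl) =
    k * d + b * l + k * l * M , solve (b ∷ d ∷ k ∷ l ∷ M ∷ [])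

  +-congʳₘ : ∀ c {a b} → a ≡ₘ b → a + c ≡ₘ b + c
  +-congʳₘ c a≡b = +-congₘ a≡b (≡ₘ-refl {c})

  sub-congʳₘ : ∀ c {a b} → a ≡ₘ b → a - c ≡ₘ b - c
  sub-congʳₘ c a≡b = sub-congₘ a≡b (≡ₘ-refl {c})

  *-congˡₘ : ∀ c {a b} → a ≡ₘ b → c * a ≡ₘ c * b
  *-congˡₘ c = *-congₘ (≡ₘ-refl {c})

  *-congʳₘ : ∀ c {a b} → a ≡ₘ b → a * c ≡ₘ b * c
  *-congʳₘ c a≡b = *-congₘ a≡b (≡ₘ-refl {c})

record ℤ[i] : Set where
  constructor _,_
  field
    re im : ℤ

infixr 4 _,_
open ℤ[i]

infixl 6 _⊕_
infixl 7 _⊗_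

_⊕_ : ℤ[i] → ℤ[i] → ℤ[i]
(a , b) ⊕ (c , d) = a + c , b + d

_⊗_ : ℤ[i] → ℤ[i] → ℤ[i]
(a , b) ⊗ (c , d) = a * c - b * d , a * d + b * c

0ᵍ 1ᵍ 𝕚 : ℤ[i]
0ᵍ = + 0 , + 0
1ᵍ = + 1 , + 0
𝕚  = + 0 , + 1

ι : ℕ → ℤ[i]
ι n = + n , + 0

conj : ℤ[i] → ℤ[i]
conj (a , b) = a , - b

module GaussianMod (q : ℕ) where
  open Congruence (+ q) public

  infix 4 _≈_
  record _≈_ (x y : ℤ[i]) : Set where
    constructor _,_
    field
      re≡ₘ : re x ≡ₘ re y
      im≡ₘ : im x ≡ₘ im y

  ≡⇒≈ : ∀ {x y} → re x ≡ re y → im x ≡ im y → x ≈ y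
  ≡⇒≈ p r = ≡⇒≡ₘ p , ≡⇒≡ₘ r

  ⊕-cong : ∀ {x y u v} → x ≈ y → u ≈ v → x ⊕ u ≈ y ⊕ v
  ⊕-cong (r , i) (r′ , i′) = +-congₘ r r′ , +-congₘ i i′

  ⊗-cong : ∀ {x y u v} → x ≈ y → u ≈ v → x ⊗ u ≈ y ⊗ v
  ⊗-cong (r , i) (r′ , i′) =
    sub-congₘ (*-congₘ r r′) (*-congₘ i i′) , +-congₘ (*-congₘ r i′) (*-congₘ i r′)

  isCommutativeSemiring : IsCommutativeSemiring _≈_ _⊕_ _⊗_ 0ᵍ 1ᵍ
  isCommutativeSemiring = isCommutativeSemiringˡ record
    { +-isCommutativeMonoid = isCommutativeMonoidˡ record
      { isSemigroup = record
        { isMagma = record { isEquivalence = ≈-isEquivalence ; ∙-cong = ⊕-cong }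
        ; assoc = λ (a , b) (c , d) (e , f) → ≡⇒≈ (ℤ.+-assoc a c e) (ℤ.+-assoc b d f) }
      ; identityˡ = λ (a , b) → ≡⇒≈ (ℤ.+-identityˡ a) (ℤ.+-identityˡ b)
      ; comm = λ (a , b) (c , d) → ≡⇒≈ (ℤ.+-comm a c) (ℤ.+-comm b d) }
    ; *-isCommutativeMonoid = isCommutativeMonoidˡ record
      { isSemigroup = record
        { isMagma = record { isEquivalence = ≈-isEquivalence ; ∙-cong = ⊗-cong }
        ; assoc = λ (a , b) (c , d) (e , f) → ≡⇒≈ (assoc₁ a b c d e f) (assoc₂ a b c d e f) }
      ; identityˡ = λ (a , b) → ≡⇒≈ (identity₁ a b) (identity₂ a b)
      ; comm = λ (a , b) (c , d) → ≡⇒≈ (comm₁ a b c d) (comm₂ a b c d) }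
    ; distribʳ = λ (a , b) (c , d) (e , f) → ≡⇒≈ (distrib₁ a b c d e f) (distrib₂ a b c d e f)
    ; zeroˡ = λ (a , b) → ≡⇒≈ (zero₁ a b) (zero₂ a b)
    }
    where
    ≈-isEquivalence : IsEquivalence _≈_
    ≈-isEquivalence = record
      { refl = ≡ₘ-refl , ≡ₘ-refl
      ; sym = λ (r , i) → ≡ₘ-sym r , ≡ₘ-sym i
      ; trans = λ (r , i) (r′ , i′) → ≡ₘ-trans r r′ , ≡ₘ-trans i i′ }
    assoc₁ : ∀ a b c d e f → (a * c - b * d) * e - (a * d + b * c) * f ≡ a * (c * e - d * f) - b * (c * f + d * e)
    assoc₁ = solve-∀
    assoc₂ : ∀ a b c d e f → (a * c - b * d) * f + (a * d + b * c) * e ≡ a * (c * f + d * e) + b * (c * e - d * f)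
    assoc₂ = solve-∀
    identity₁ : ∀ a b → + 1 * a - + 0 * b ≡ a
    identity₁ = solve-∀
    identity₂ : ∀ a b → + 1 * b + + 0 * a ≡ b
    identity₂ = solve-∀
    comm₁ : ∀ a b c d → a * c - b * d ≡ c * a - d * b
    comm₁ = solve-∀
    comm₂ : ∀ a b c d → a * d + b * c ≡ c * b + d * a
    comm₂ = solve-∀
    distrib₁ : ∀ a b c d e f → (c + e) * a - (d + f) * b ≡ (c * a - d * b) + (e * a - f * b)
    distrib₁ = solve-∀
    distrib₂ : ∀ a b c d e f → (c + e) * b + (d + f) * a ≡ (c * b + d * a) + (e * b + f * a)
    distrib₂ = solve-∀
    zero₁ : ∀ a b → + 0 * a - + 0 * b ≡ + 0
    zero₁ = solve-∀
    zero₂ : ∀ a b → + 0 * b + + 0 * a ≡ + 0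
    zero₂ = solve-∀

  commutativeSemiring : CommutativeSemiring 0ℓ 0ℓ
  commutativeSemiring = record { isCommutativeSemiring = isCommutativeSemiring }

  open CommutativeSemiring commutativeSemiring public
    using (setoid; semiring; +-rawMonoid)
    renaming (refl to ≈-refl; sym to ≈-sym; trans to ≈-trans; *-identityʳ to ⊗-identityʳ)
  open RawMonoid +-rawMonoid public using (_×_)
  open import Algebra.Properties.Semiring.Exp semiring public using (_^_; ^-congˡ; ^-congʳ; ^-assocʳ)

  ι≈n×1 : ∀ n → ι n ≈ n × 1ᵍ
  ι≈n×1 zero    = ≈-refl
  ι≈n×1 (suc n) = ⊕-cong {1ᵍ} ≈-refl (ι≈n×1 n)

  q×1≈0 : q × 1ᵍ ≈ 0ᵍ
  q×1≈0 = ≈-trans (≈-sym (ι≈n×1 q)) ((+ 1 , ≡.sym (≡.trans (ℤ.+-identityˡ _) (ℤ.*-identityˡ _))) , ≡ₘ-refl)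

  -- With T = 1/2 and R = √3, ζ = (√3 + i)/2 = e^{iπ/6}.
  module RootOfUnity (T R : ℤ) (half : + 2 * T ≡ₘ + 1) (root : R * R ≡ₘ + 3) where
    open SetoidReasoning ≡ₘ-setoid

    T*x≡0⇒x≡0 : ∀ {x} → T * x ≡ₘ + 0 → x ≡ₘ + 0
    T*x≡0⇒x≡0 {x} Tx≡0 = begin
      x                ≡⟨ solve (x ∷ []) ⟩
      + 1 * x          ≈⟨ *-congʳₘ x half ⟨
      + 2 * T * x      ≡⟨ solve (x ∷ T ∷ []) ⟩
      + 2 * (T * x)    ≈⟨ *-congˡₘ (+ 2) Tx≡0 ⟩
      + 0              ∎

    ζ : ℤ[i]
    ζ = T * R , T

    ζ≈T[R+𝕚] : ζ ≈ (T , + 0) ⊗ ((R , + 0) ⊕ 𝕚)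
    ζ≈T[R+𝕚] = ≡⇒≈ re-part im-part
      where
      re-part : T * R ≡ T * (R + + 0) - + 0 * + 1
      re-part = solve (T ∷ R ∷ [])
      im-part : T ≡ T * + 1 + + 0 * (R + + 0)
      im-part = solve (T ∷ R ∷ [])

    conjζ≈T[R+𝕚³] : conj ζ ≈ (T , + 0) ⊗ ((R , + 0) ⊕ 𝕚 ^ 3)
    conjζ≈T[R+𝕚³] = ≡⇒≈ re-part im-part
      where
      re-part : T * R ≡ T * (R + + 0) - + 0 * - + 1
      re-part = solve (T ∷ R ∷ [])
      im-part : - T ≡ T * - + 1 + + 0 * (R + + 0)
      im-part = solve (T ∷ R ∷ [])

    ζ⊗ζ≈[T,TR] : ζ ⊗ ζ ≈ (T , T * R)
    ζ⊗ζ≈[T,TR] = re-part , im-part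
      where
      re-part : T * R * (T * R) - T * T ≡ₘ T
      re-part = begin
        T * R * (T * R) - T * T    ≡⟨ solve (T ∷ R ∷ []) ⟩
        T * T * (R * R) - T * T    ≈⟨ sub-congʳₘ (T * T) (*-congˡₘ (T * T) root) ⟩
        T * T * + 3 - T * T        ≡⟨ solve (T ∷ []) ⟩
        + 2 * T * T                ≈⟨ *-congʳₘ T half ⟩
        + 1 * T                    ≡⟨ solve (T ∷ []) ⟩
        T                          ∎
      im-part : T * R * T + T * (T * R) ≡ₘ T * R
      im-part = begin
        T * R * T + T * (T * R)    ≡⟨ solve (T ∷ R ∷ []) ⟩
        + 2 * T * (T * R)          ≈⟨ *-congʳₘ (T * R) half ⟩
        + 1 * (T * R)              ≡⟨ solve (T ∷ R ∷ []) ⟩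
        T * R                      ∎

    ζ⊗[T,TR]≈𝕚 : ζ ⊗ (T , T * R) ≈ 𝕚
    ζ⊗[T,TR]≈𝕚 = ≡⇒≡ₘ re-part , im-part
      where
      re-part : T * R * T - T * (T * R) ≡ + 0
      re-part = solve (T ∷ R ∷ [])
      im-part : T * R * (T * R) + T * T ≡ₘ + 1
      im-part = begin
        T * R * (T * R) + T * T    ≡⟨ solve (T ∷ R ∷ []) ⟩
        T * T * (R * R) + T * T    ≈⟨ +-congʳₘ (T * T) (*-congˡₘ (T * T) root) ⟩
        T * T * + 3 + T * T        ≡⟨ solve (T ∷ []) ⟩
        (+ 2 * T) * (+ 2 * T)      ≈⟨ *-congₘ half half ⟩
        + 1                        ∎

    ζ³≈𝕚 : ζ ^ 3 ≈ 𝕚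
    ζ³≈𝕚 = ≈-trans (⊗-cong {ζ} ≈-refl (≈-trans (⊗-cong {ζ} ≈-refl (⊗-identityʳ ζ)) ζ⊗ζ≈[T,TR])) ζ⊗[T,TR]≈𝕚

    ζ^3k≈𝕚^k : ∀ k → ζ ^ (3 ℕ.* k) ≈ 𝕚 ^ k
    ζ^3k≈𝕚^k k = ≈-trans (≈-sym (^-assocʳ ζ 3 k)) (^-congˡ k ζ³≈𝕚)

    ζ²≈𝕚²⇒R≡0 : ζ ⊗ ζ ≈ 𝕚 ^ 2 → R ≡ₘ + 0
    ζ²≈𝕚²⇒R≡0 ζ²≈𝕚² = T*x≡0⇒x≡0 (_≈_.im≡ₘ (≈-trans (≈-sym ζ⊗ζ≈[T,TR]) ζ²≈𝕚²))

    conjζ≈ζ𝕚²⇒R≡0 : conj ζ ≈ ζ ⊗ 𝕚 ^ 2 → R ≡ₘ + 0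
    conjζ≈ζ𝕚²⇒R≡0 conjζ≈ζ𝕚² = T*x≡0⇒x≡0 (begin
      T * R                                  ≡⟨ solve (T ∷ R ∷ []) ⟩
      + 1 * (T * R)                          ≈⟨ *-congʳₘ (T * R) half ⟨
      + 2 * T * (T * R)                      ≡⟨ solve (T ∷ R ∷ []) ⟩
      T * (T * R + T * R)                    ≈⟨ *-congˡₘ T (+-congʳₘ (T * R) (_≈_.re≡ₘ conjζ≈ζ𝕚²)) ⟩
      T * (T * R * - + 1 - T * + 0 + T * R)  ≡⟨ solve (T ∷ R ∷ []) ⟩
      + 0                                    ∎)

module _ {p} (p-prime : Prime p) where
  open GaussianMod p
  open Frobenius commutativeSemiring using (frobenius; fermat)
  open Powers semiring using (^-periodic)
  open import Algebra.Properties.CommutativeSemiring.Exp commutativeSemiring using (^-distrib-*)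
  open SetoidReasoning setoid

  ι^p≈ι : ∀ n → ι n ^ p ≈ ι n
  ι^p≈ι n = ≈-trans (^-congˡ p (ι≈n×1 n)) (≈-trans (fermat p-prime q×1≈0 n) (≈-sym (ι≈n×1 n)))

  𝕚^[4n+s]≈𝕚^s : ∀ n s → 𝕚 ^ (4 ℕ.* n ℕ.+ s) ≈ 𝕚 ^ s
  𝕚^[4n+s]≈𝕚^s = ^-periodic {𝕚} {4} ≈-refl

  module _ (t r : ℕ) (half : + 2 * + t ≡ₘ + 1) (root : + r * + r ≡ₘ + 3) where
    open RootOfUnity (+ t) (+ r) half root

    ζ^p≈t[r+𝕚^p] : ζ ^ p ≈ ι t ⊗ (ι r ⊕ 𝕚 ^ p)
    ζ^p≈t[r+𝕚^p] = begin
      ζ ^ p                    ≈⟨ ^-congˡ p ζ≈T[R+𝕚] ⟩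
      (ι t ⊗ (ι r ⊕ 𝕚)) ^ p    ≈⟨ ^-distrib-* (ι t) (ι r ⊕ 𝕚) p ⟩
      ι t ^ p ⊗ (ι r ⊕ 𝕚) ^ p  ≈⟨ ⊗-cong (ι^p≈ι t) (frobenius p-prime q×1≈0 (ι r) 𝕚) ⟩
      ι t ⊗ (ι r ^ p ⊕ 𝕚 ^ p)  ≈⟨ ⊗-cong {ι t} ≈-refl (⊕-cong (ι^p≈ι r) ≈-refl) ⟩
      ι t ⊗ (ι r ⊕ 𝕚 ^ p)      ∎

    ζ^[12n+s]≈ζ^s : ∀ n s → ζ ^ (12 ℕ.* n ℕ.+ s) ≈ ζ ^ s
    ζ^[12n+s]≈ζ^s = ^-periodic {ζ} {12} (ζ^3k≈𝕚^k 4)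

    p≡12n+5⇒r≡0 : ∀ n → p ≡ 12 ℕ.* n ℕ.+ 5 → + r ≡ₘ + 0
    p≡12n+5⇒r≡0 n ≡.refl = ζ²≈𝕚²⇒R≡0 (begin
      ζ ⊗ ζ                ≈⟨ ⊗-cong {ζ} ≈-refl ζ⁵≈ζ ⟨
      ζ ^ 6                ≈⟨ ζ^3k≈𝕚^k 2 ⟩
      𝕚 ^ 2                ∎)
      where
      12n+5≡4[3n+1]+1 : ∀ n → 12 ℕ.* n ℕ.+ 5 ≡ 4 ℕ.* (3 ℕ.* n ℕ.+ 1) ℕ.+ 1
      12n+5≡4[3n+1]+1 = ℕ-Solver.solve-∀
      𝕚^p≈𝕚 : 𝕚 ^ p ≈ 𝕚
      𝕚^p≈𝕚 = ≈-trans (^-congʳ 𝕚 (12n+5≡4[3n+1]+1 n))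
                (≈-trans (𝕚^[4n+s]≈𝕚^s (3 ℕ.* n ℕ.+ 1) 1) (⊗-identityʳ 𝕚))
      ζ⁵≈ζ : ζ ^ 5 ≈ ζ
      ζ⁵≈ζ = begin
        ζ ^ 5                ≈⟨ ζ^[12n+s]≈ζ^s n 5 ⟨
        ζ ^ p                ≈⟨ ζ^p≈t[r+𝕚^p] ⟩
        ι t ⊗ (ι r ⊕ 𝕚 ^ p)  ≈⟨ ⊗-cong {ι t} ≈-refl (⊕-cong {ι r} ≈-refl 𝕚^p≈𝕚) ⟩
        ι t ⊗ (ι r ⊕ 𝕚)      ≈⟨ ζ≈T[R+𝕚] ⟨
        ζ                    ∎

    p≡12n+7⇒r≡0 : ∀ n → p ≡ 12 ℕ.* n ℕ.+ 7 → + r ≡ₘ + 0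
    p≡12n+7⇒r≡0 n ≡.refl = conjζ≈ζ𝕚²⇒R≡0 (begin
      conj ζ               ≈⟨ conjζ≈T[R+𝕚³] ⟩
      ι t ⊗ (ι r ⊕ 𝕚 ^ 3)  ≈⟨ ⊗-cong {ι t} ≈-refl (⊕-cong {ι r} ≈-refl 𝕚^p≈𝕚³) ⟨
      ι t ⊗ (ι r ⊕ 𝕚 ^ p)  ≈⟨ ζ^p≈t[r+𝕚^p] ⟨
      ζ ^ p                ≈⟨ ζ^[12n+s]≈ζ^s n 7 ⟩
      ζ ⊗ ζ ^ 6            ≈⟨ ⊗-cong {ζ} ≈-refl (ζ^3k≈𝕚^k 2) ⟩
      ζ ⊗ 𝕚 ^ 2            ∎)
      where
      12n+7≡4[3n+1]+3 : ∀ n → 12 ℕ.* n ℕ.+ 7 ≡ 4 ℕ.* (3 ℕ.* n ℕ.+ 1) ℕ.+ 3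
      12n+7≡4[3n+1]+3 = ℕ-Solver.solve-∀
      𝕚^p≈𝕚³ : 𝕚 ^ p ≈ 𝕚 ^ 3
      𝕚^p≈𝕚³ = ≈-trans (^-congʳ 𝕚 (12n+7≡4[3n+1]+3 n)) (𝕚^[4n+s]≈𝕚^s (3 ℕ.* n ℕ.+ 1) 3)

  2*t≡ₘ1 : ∀ t → 2 ℕ.* t ≡ 1 ℕ.+ p → + 2 * + t ≡ₘ + 1
  2*t≡ₘ1 t 2t≡1+p = + 1 , ≡.trans (≡.sym (ℤ.pos-* 2 t))
    (≡.trans (≡.cong +_ 2t≡1+p) (≡.cong (_+_ (+ 1)) (≡.sym (ℤ.*-identityˡ (+ p)))))

  r²≡3⇒r≡0 : ∀ n → p ≡ 12 ℕ.* n ℕ.+ 5 ⊎ p ≡ 12 ℕ.* n ℕ.+ 7 → ∀ r → + r * + r ≡ₘ + 3 → + r ≡ₘ + 0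
  r²≡3⇒r≡0 n (inj₁ p≡12n+5) r root =
    p≡12n+5⇒r≡0 t r (2*t≡ₘ1 t (≡.trans (2t≡12n+6 n) (≡.cong suc (≡.sym p≡12n+5)))) root n p≡12n+5
    where
    t : ℕ
    t = 6 ℕ.* n ℕ.+ 3
    2t≡12n+6 : ∀ n → 2 ℕ.* (6 ℕ.* n ℕ.+ 3) ≡ 1 ℕ.+ (12 ℕ.* n ℕ.+ 5)
    2t≡12n+6 = ℕ-Solver.solve-∀
  r²≡3⇒r≡0 n (inj₂ p≡12n+7) r root =
    p≡12n+7⇒r≡0 t r (2*t≡ₘ1 t (≡.trans (2t≡12n+8 n) (≡.cong suc (≡.sym p≡12n+7)))) root n p≡12n+7
    where
    t : ℕ
    t = 6 ℕ.* n ℕ.+ 4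
    2t≡12n+8 : ∀ n → 2 ℕ.* (6 ℕ.* n ℕ.+ 4) ≡ 1 ℕ.+ (12 ℕ.* n ℕ.+ 7)
    2t≡12n+8 = ℕ-Solver.solve-∀

  ¬square≡3 : ∀ n → p ≡ 12 ℕ.* n ℕ.+ 5 ⊎ p ≡ 12 ℕ.* n ℕ.+ 7 → ∀ x → ¬ (x * x ≡ₘ + 3)
  ¬square≡3 n p≡12n+5∨7 x x²≡3 = 5≰3 (ℕ.≤-trans (5≤p p≡12n+5∨7) (∣⇒≤ p∣3))
    where
    instance
      p≢0 : ℕ.NonZero p
      p≢0 = prime⇒nonZero p-prime
    -- x is replaced by a natural residue because `fermat` is about n × 1#.
    r : ℕ
    r = x %ℕ p
    x≡r : x ≡ₘ + r
    x≡r = x /ℕ p , a≡a%ℕn+[a/ℕn]*n x p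
    r²≡3 : + r * + r ≡ₘ + 3
    r²≡3 = ≡ₘ-trans (≡ₘ-sym (*-congₘ x≡r x≡r)) x²≡3
    r≡0 : + r ≡ₘ + 0
    r≡0 = r²≡3⇒r≡0 n p≡12n+5∨7 r r²≡3
    3≡0 : + 3 ≡ₘ + 0
    3≡0 = ≡ₘ-trans (≡ₘ-sym r²≡3) (*-congₘ r≡0 r≡0)
    p∣3 : p ∣ 3
    p∣3 = ∣⇒∣ᵤ (divides (_≡ₘ_.quotient 3≡0) (≡.trans (_≡ₘ_.equation 3≡0) (ℤ.+-identityˡ _)))
    5≤p : p ≡ 12 ℕ.* n ℕ.+ 5 ⊎ p ≡ 12 ℕ.* n ℕ.+ 7 → 5 ℕ.≤ p
    5≤p (inj₁ ≡.refl) = ℕ.m≤n+m 5 (12 ℕ.* n)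
    5≤p (inj₂ ≡.refl) = ℕ.≤-trans (ℕ.m≤n+m 5 2) (ℕ.m≤n+m 7 (12 ℕ.* n))
    5≰3 : ¬ 5 ℕ.≤ 3
    5≰3 (s≤s (s≤s (s≤s ())))

cross : Point → Point → Point → ℤ
cross (a₁ , a₂) (b₁ , b₂) (c₁ , c₂) = (b₁ - a₁) * (c₂ - a₂) - (b₂ - a₂) * (c₁ - a₁)

-- Archimedes' formula: both sides are 16 times the squared area of the triangle ABC.
archimedes : ∀ A B C → let P = quadrance A B ; R = quadrance A C ; S = quadrance B C in
  (+ 2 * cross A B C) * (+ 2 * cross A B C) ≡ + 4 * P * R - (P + R - S) * (P + R - S)
archimedes (a₁ , a₂) (b₁ , b₂) (c₁ , c₂) = identity a₁ a₂ b₁ b₂ c₁ c₂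
  where
  identity : ∀ a₁ a₂ b₁ b₂ c₁ c₂ →
    let x = + 2 * ((b₁ - a₁) * (c₂ - a₂) - (b₂ - a₂) * (c₁ - a₁))
        P = (b₁ - a₁) * (b₁ - a₁) + (b₂ - a₂) * (b₂ - a₂)
        R = (c₁ - a₁) * (c₁ - a₁) + (c₂ - a₂) * (c₂ - a₂)
        S = (c₁ - b₁) * (c₁ - b₁) + (c₂ - b₂) * (c₂ - b₂)
    in x * x ≡ + 4 * P * R - (P + R - S) * (P + R - S)
  identity = solve-∀

module _ (q : ℕ) where
  open Congruence (+ q)
  open SetoidReasoning ≡ₘ-setoid

  ≡[mod]⇒≡ₘ : ∀ {a b} → a ≡ b [mod q ] → a ≡ₘ b
  ≡[mod]⇒≡ₘ {a} {b} q∣a-b with ∣ᵤ⇒∣ q∣a-b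
  ... | divides k a-b≡k*q = k , ≡.trans a≡b+[a-b] (≡.cong (_+_ b) a-b≡k*q)
    where
    a≡b+[a-b] : a ≡ b + (a - b)
    a≡b+[a-b] = solve (a ∷ b ∷ [])

  triangle⇒square≡3 : ∀ A B C → IsTriangle q A B C → ∃ λ x → x * x ≡ₘ + 3
  triangle⇒square≡3 A B C ((_ , AB≡1) , (_ , BC≡1) , (_ , AC≡1)) = + 2 * cross A B C , (begin
    (+ 2 * cross A B C) * (+ 2 * cross A B C)  ≡⟨ archimedes A B C ⟩
    + 4 * P * R - (P + R - S) * (P + R - S)    ≈⟨ sub-congₘ (*-congₘ (*-congˡₘ (+ 4) P≡1) R≡1)
                                                            (*-congₘ P+R-S≡1 P+R-S≡1) ⟩
    + 4 * + 1 * + 1 - + 1 * + 1                ≡⟨⟩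
    + 3                                        ∎)
    where
    P R S : ℤ
    P = quadrance A B
    R = quadrance A C
    S = quadrance B C
    P≡1 : P ≡ₘ + 1
    P≡1 = ≡[mod]⇒≡ₘ AB≡1
    R≡1 : R ≡ₘ + 1
    R≡1 = ≡[mod]⇒≡ₘ AC≡1
    P+R-S≡1 : P + R - S ≡ₘ + 1
    P+R-S≡1 = sub-congₘ (+-congₘ P≡1 R≡1) (≡[mod]⇒≡ₘ {S} {+ 1} BC≡1)

12k±7⇒12n+5∨12n+7 : ∀ {q} k → + q ≡ + 12 * k + + 7 ⊎ + q ≡ + 12 * k - + 7 →
                    ∃ λ n → q ≡ 12 ℕ.* n ℕ.+ 5 ⊎ q ≡ 12 ℕ.* n ℕ.+ 7
12k±7⇒12n+5∨12n+7 (+ n) (inj₁ q≡12n+7) =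
  n , inj₂ (ℤ.+-injective (≡.trans q≡12n+7 (≡.cong (_+ + 7) (≡.sym (ℤ.pos-* 12 n)))))
12k±7⇒12n+5∨12n+7 (+ zero) (inj₂ ())
12k±7⇒12n+5∨12n+7 (+ suc n) (inj₂ q≡12[n+1]-7) =
  n , inj₁ (ℤ.+-injective (≡.trans q≡12[n+1]-7 (≡.trans (identity (+ n)) (≡.cong (_+ + 5) (≡.sym (ℤ.pos-* 12 n))))))
  where
  identity : ∀ N → + 12 * (+ 1 + N) - + 7 ≡ + 12 * N + + 5
  identity = solve-∀
12k±7⇒12n+5∨12n+7 -[1+ n ] (inj₁ q≡12k+7) =
  contradiction (≡.trans q≡12k+7 (≡.trans (identity (+ n)) (≡.cong (λ m → - (+ 5 + m)) (≡.sym (ℤ.pos-* 12 n))))) λ ()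
  where
  identity : ∀ N → + 12 * - (+ 1 + N) + + 7 ≡ - (+ 5 + + 12 * N)
  identity = solve-∀
12k±7⇒12n+5∨12n+7 -[1+ n ] (inj₂ q≡12k-7) =
  contradiction (≡.trans q≡12k-7 (≡.trans (identity (+ n)) (≡.cong (λ m → - (+ 19 + m)) (≡.sym (ℤ.pos-* 12 n))))) λ ()
  where
  identity : ∀ N → + 12 * - (+ 1 + N) - + 7 ≡ - (+ 19 + + 12 * N)
  identity = solve-∀

lemma6 : (q : ℕ) → Prime q →
    (∃ λ (k : ℤ) → (+ q ≡ (+ 12) * k + + 7) ⊎ (+ q ≡ (+ 12) * k - + 7)) →
    (A B C : Point) → ¬ IsTriangle q A B C
lemma6 q q-prime (k , q≡12k±7) A B C triangle =
  let n , q≡12n+5∨7 = 12k±7⇒12n+5∨12n+7 k q≡12k±7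
      x , x²≡3 = triangle⇒square≡3 q A B C triangle
  in ¬square≡3 q-prime n q≡12n+5∨7 x x²≡3
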